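{- There are terms $s,t$ of Gödel's system $T$ of lowest level such that $$(\forall\Lambda)\big(\mathsf{WFF}(\Lambda)\to\mathsf{WCF}(t(\Lambda))\big)\wedge(\forall\eta)\big(\mathsf{WCF}(\eta)\to\mathsf{WFF}(s(\eta))\big).$$
   Context: $C=2^{\mathbb N}$ with coin-toss measure $\mathbf m$; $\bar\alpha n=\langle\alpha(0),\dots,\alpha(n-1)\rangle$; $f\in[\sigma]$ means $\bar f|\sigma|=\sigma$; $T\le1$ ranges over binary trees. For a binary tree $T$, $L_n(T)=|\{\sigma\in T:|\sigma|=n\}|/2^n$. $\mathsf{WFF}(\Lambda)$ for $\Lambda$ of type $(2\times0)\to1^*$: for all $G^2$ and $k^0$, $\mathbf m(\{f\in C:(\exists g\in\Lambda(G,k))(f\in[\bar gG(g)])\})\ge1-2^{ -k}$. $\mathsf{WCF}(\eta)$, with $\eta(g,k)=(\eta(g,k)(1),\eta(g,k)(2))$ a number and a finite sequence of elements of $C$: $(\forall k^0,g^2,T\le1)\big[(\forall\alpha\in\eta(g,k)(2))(\bar\alpha g(\alpha)\notin T)\to L_{\eta(g,k)(1)}(T)\le 2^{ -k}\big]$. -}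

module Defs where

open import Data.Nat using (ℕ; zero; suc; _+_; _*_; _∸_; _^_; _≤_; _<_; _⊔_; _≡ᵇ_)
open import Data.Bool using (Bool; true; false; _∧_; _∨_)
open import Data.List using (List; []; _∷_; map; upTo; length; filterᵇ; foldr; concatMap)
open import Data.Product using (_×_; _,_; proj₁; proj₂)
open import Relation.Binary.PropositionalEquality using (_≡_)

-- Goedel's system T (with product types), "lowest level" fragment T₀:
-- the recursor is available only at type 0 (R₀).

infixr 5 _⇒_
infixr 6 _⊗_

data Ty : Set where
  ι   : Ty
  _⇒_ : Ty → Ty → Ty
  _⊗_ : Ty → Ty → Ty

⟦_⟧ : Ty → Set
⟦ ι ⟧     = ℕ
⟦ σ ⇒ τ ⟧ = ⟦ σ ⟧ → ⟦ τ ⟧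
⟦ σ ⊗ τ ⟧ = ⟦ σ ⟧ × ⟦ τ ⟧

Ctx : Set
Ctx = List Ty

data _∋_ : Ctx → Ty → Set where
  here  : ∀ {Γ σ} → (σ ∷ Γ) ∋ σ
  there : ∀ {Γ σ τ} → Γ ∋ σ → (τ ∷ Γ) ∋ σ

data Tm (Γ : Ctx) : Ty → Set where
  var  : ∀ {σ} → Γ ∋ σ → Tm Γ σ
  lam  : ∀ {σ τ} → Tm (σ ∷ Γ) τ → Tm Γ (σ ⇒ τ)
  app  : ∀ {σ τ} → Tm Γ (σ ⇒ τ) → Tm Γ σ → Tm Γ τ
  zer  : Tm Γ ι
  suc' : Tm Γ (ι ⇒ ι)
  rec₀ : Tm Γ (ι ⇒ (ι ⇒ ι ⇒ ι) ⇒ ι ⇒ ι)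
  pair : ∀ {σ τ} → Tm Γ σ → Tm Γ τ → Tm Γ (σ ⊗ τ)
  fst  : ∀ {σ τ} → Tm Γ (σ ⊗ τ) → Tm Γ σ
  snd  : ∀ {σ τ} → Tm Γ (σ ⊗ τ) → Tm Γ τ

data Env : Ctx → Set where
  ε   : Env []
  _▹_ : ∀ {σ Γ} → ⟦ σ ⟧ → Env Γ → Env (σ ∷ Γ)

lookupEnv : ∀ {Γ σ} → Env Γ → Γ ∋ σ → ⟦ σ ⟧
lookupEnv (x ▹ ρ) here      = x
lookupEnv (x ▹ ρ) (there v) = lookupEnv ρ v

R₀ : ℕ → (ℕ → ℕ → ℕ) → ℕ → ℕ
R₀ x y zero    = x
R₀ x y (suc n) = y n (R₀ x y n)

eval : ∀ {Γ σ} → Tm Γ σ → Env Γ → ⟦ σ ⟧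
eval (var v)    ρ = lookupEnv ρ v
eval (lam t)    ρ = λ x → eval t (x ▹ ρ)
eval (app t u)  ρ = eval t ρ (eval u ρ)
eval zer        ρ = zero
eval suc'       ρ = suc
eval rec₀       ρ = R₀
eval (pair t u) ρ = eval t ρ , eval u ρ
eval (fst t)    ρ = proj₁ (eval t ρ)
eval (snd t)    ρ = proj₂ (eval t ρ)

-- semantics of a closed term (full set-theoretic type structure, here Agda functions)
⟦_⟧ᶜ : ∀ {σ} → Tm [] σ → ⟦ σ ⟧
⟦ t ⟧ᶜ = eval t ε

ty1 : Ty
ty1 = ι ⇒ ι

ty2 : Ty
ty2 = ty1 ⇒ ι

-- type 1* : finite sequences of type-1 objects, coded as (length , β)
-- where the i-th element is β i  (i < length).
ty1* : Ty
ty1* = ι ⊗ (ι ⇒ ty1)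

-- Λ : (2 × 0) → 1*   (curried)
tyΛ : Ty
tyΛ = ty2 ⇒ ι ⇒ ty1*

-- η : (2 × 0) → 0 × 1*  ;  η(g,k)(1) = first component, η(g,k)(2) = second
tyη : Ty
tyη = ty2 ⇒ ι ⇒ (ι ⊗ ty1*)

bar : (ℕ → ℕ) → ℕ → List ℕ
bar α n = map α (upTo n)

prefixᵇ : List ℕ → List ℕ → Bool
prefixᵇ []       τ        = true
prefixᵇ (x ∷ σ)  []       = false
prefixᵇ (x ∷ σ)  (y ∷ τ)  = (x ≡ᵇ y) ∧ prefixᵇ σ τ

bins : ℕ → List (List ℕ)
bins zero    = [] ∷ []
bins (suc n) = concatMap (λ σ → (0 ∷ σ) ∷ (1 ∷ σ) ∷ []) (bins n)

anyᵇ : {A : Set} → (A → Bool) → List A → Bool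
anyᵇ p []       = false
anyᵇ p (x ∷ xs) = p x ∨ anyᵇ p xs

allᵇ : {A : Set} → (A → Bool) → List A → Bool
allᵇ p []       = true
allᵇ p (x ∷ xs) = p x ∧ allᵇ p xs

countᵇ : (List ℕ → Bool) → ℕ → ℕ
countᵇ p n = length (filterᵇ p (bins n))

elems : ⟦ ty1* ⟧ → List (ℕ → ℕ)
elems (len , β) = map β (upTo len)

-- measure of the finite union of cylinders ⋃_{g ∈ Λ(G,k)} [ḡ G(g)] is
-- (number of σ ∈ 2^N hitting some cylinder) / 2^N, where N bounds all lengths.
cylLen : ⟦ ty2 ⟧ → ⟦ ty1* ⟧ → ℕ
cylLen G s = foldr (λ g m → G g ⊔ m) 0 (elems s)

cylHit : ⟦ ty2 ⟧ → ⟦ ty1* ⟧ → List ℕ → Bool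
cylHit G s σ = anyᵇ (λ g → prefixᵇ (bar g (G g)) σ) (elems s)

-- m(⋃ …) ≥ 1 - 2^{-k}  ⇔  count · 2^k ≥ (2^k - 1) · 2^N
WFF : ⟦ tyΛ ⟧ → Set
WFF Λ = ∀ (G : ⟦ ty2 ⟧) (k : ℕ) →
  (2 ^ k ∸ 1) * 2 ^ cylLen G (Λ G k) ≤ countᵇ (cylHit G (Λ G k)) (cylLen G (Λ G k)) * 2 ^ k

IsBinTree : (List ℕ → Bool) → Set
IsBinTree T =
  (∀ σ → T σ ≡ true → allᵇ (λ x → (x ≡ᵇ 0) ∨ (x ≡ᵇ 1)) σ ≡ true) ×
  (∀ σ τ → prefixᵇ σ τ ≡ true → T τ ≡ true → T σ ≡ true)

-- L_n(T) ≤ 2^{-k}  ⇔  |{σ ∈ T : |σ| = n}| · 2^k ≤ 2^n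
WCF : ⟦ tyη ⟧ → Set
WCF η = ∀ (k : ℕ) (g : ⟦ ty2 ⟧) (T : List ℕ → Bool) → IsBinTree T →
  (∀ α → α ∈ℓ elems (proj₂ (η g k)) → T (bar α (g α)) ≡ false) →
  countᵇ T (proj₁ (η g k)) * 2 ^ k ≤ 2 ^ proj₁ (η g k)
  where
  open import Data.List.Membership.Propositional renaming (_∈_ to _∈ℓ_)

-- Both principles compare the same quantity: the proportion of binary sequences of length m that
-- avoid a finite family of cylinders [ḡ G(g)].  This proportion is nonincreasing in m (the
-- uncovered sequences form a tree), and it is constant from the maximal stem length N onwards
-- (coverage is decided by the first N bits).  Hence a bound 2^-k at any level n transfers to
-- level N, which turns WCF into WFF with the same family; conversely WFF gives the bound at N, hence
-- at every n ≥ N, and any tree avoiding the stems lies inside the uncovered sequences.  The only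
-- computation the terms perform is an upper bound for N, the sum of the stem lengths, by R₀.

module Submission where

open import Defs
open import Data.Bool using (Bool; true; false; _∧_; _∨_; not; T)
open import Data.Bool.Properties using (∧-conicalˡ; ∧-conicalʳ; ∧-zeroʳ)
open import Data.List using (List; []; _∷_; upTo; length; filterᵇ; foldr; concatMap)
open import Data.List.Properties using (length-map; length-upTo)
open import Data.List.Membership.Propositional using (_∈_)
open import Data.List.Membership.Propositional.Properties using (∈-map⁻; ∈-upTo⁻)
open import Data.List.Relation.Unary.Any using (here; there)
open import Data.Nat using (ℕ; zero; suc; _+_; _*_; _∸_; _^_; _≤_; _<_; _⊔_; _≡ᵇ_; z≤n; s≤s; NonZero)
open import Data.Nat.Properties
open import Algebra.Properties.CommutativeSemigroup +-commutativeSemigroup using (interchange)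
open import Data.Product using (Σ; ∃; _×_; _,_; proj₁; proj₂)
open import Data.Sum using (inj₁; inj₂)
open import Function using (_∘_)
open import Relation.Binary.PropositionalEquality

toℕ : Bool → ℕ
toℕ true  = 1
toℕ false = 0

length-filterᵇ-∷ : ∀ {A : Set} (p : A → Bool) x xs →
  length (filterᵇ p (x ∷ xs)) ≡ toℕ (p x) + length (filterᵇ p xs)
length-filterᵇ-∷ p x xs with p x
... | true  = refl
... | false = refl

length-filterᵇ-pairs : ∀ {A B : Set} (p : B → Bool) (a b : A → B) xs →
  length (filterᵇ p (concatMap (λ x → a x ∷ b x ∷ []) xs))
    ≡ length (filterᵇ (p ∘ a) xs) + length (filterᵇ (p ∘ b) xs)
length-filterᵇ-pairs p a b [] = refl
length-filterᵇ-pairs p a b (x ∷ xs) = begin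
  length (filterᵇ p (a x ∷ b x ∷ rest))
    ≡⟨ length-filterᵇ-∷ p (a x) _ ⟩
  toℕ (p (a x)) + length (filterᵇ p (b x ∷ rest))
    ≡⟨ cong (toℕ (p (a x)) +_) (length-filterᵇ-∷ p (b x) rest) ⟩
  toℕ (p (a x)) + (toℕ (p (b x)) + length (filterᵇ p rest))
    ≡⟨ cong (λ n → toℕ (p (a x)) + (toℕ (p (b x)) + n)) (length-filterᵇ-pairs p a b xs) ⟩
  toℕ (p (a x)) + (toℕ (p (b x)) + (length (filterᵇ (p ∘ a) xs) + length (filterᵇ (p ∘ b) xs)))
    ≡⟨ sym (+-assoc (toℕ (p (a x))) _ _) ⟩
  (toℕ (p (a x)) + toℕ (p (b x))) + (length (filterᵇ (p ∘ a) xs) + length (filterᵇ (p ∘ b) xs))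
    ≡⟨ interchange (toℕ (p (a x))) _ _ _ ⟩
  (toℕ (p (a x)) + length (filterᵇ (p ∘ a) xs)) + (toℕ (p (b x)) + length (filterᵇ (p ∘ b) xs))
    ≡⟨ sym (cong₂ _+_ (length-filterᵇ-∷ (p ∘ a) x xs) (length-filterᵇ-∷ (p ∘ b) x xs)) ⟩
  length (filterᵇ (p ∘ a) (x ∷ xs)) + length (filterᵇ (p ∘ b) (x ∷ xs)) ∎
  where
  open ≡-Reasoning
  rest = concatMap (λ x → a x ∷ b x ∷ []) xs

countᵇ-zero : ∀ p → countᵇ p 0 ≡ toℕ (p [])
countᵇ-zero p = trans (length-filterᵇ-∷ p [] []) (+-identityʳ _)

countᵇ-suc : ∀ p m → countᵇ p (suc m) ≡ countᵇ (p ∘ (0 ∷_)) m + countᵇ (p ∘ (1 ∷_)) m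
countᵇ-suc p m = length-filterᵇ-pairs p (0 ∷_) (1 ∷_) (bins m)

isBinary : List ℕ → Bool
isBinary = allᵇ (λ x → (x ≡ᵇ 0) ∨ (x ≡ᵇ 1))

toℕ-mono : ∀ {a b} → (a ≡ true → b ≡ true) → toℕ a ≤ toℕ b
toℕ-mono {false} _ = z≤n
toℕ-mono {true}  h rewrite h refl = ≤-refl

countᵇ-mono : ∀ p q m → (∀ σ → isBinary σ ≡ true → p σ ≡ true → q σ ≡ true) →
  countᵇ p m ≤ countᵇ q m
countᵇ-mono p q zero h rewrite countᵇ-zero p | countᵇ-zero q = toℕ-mono (h [] refl)
countᵇ-mono p q (suc m) h rewrite countᵇ-suc p m | countᵇ-suc q m =
  +-mono-≤ (countᵇ-mono _ _ m (h ∘ (0 ∷_))) (countᵇ-mono _ _ m (h ∘ (1 ∷_)))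

countᵇ-cong : ∀ p q m → (∀ σ → isBinary σ ≡ true → p σ ≡ q σ) → countᵇ p m ≡ countᵇ q m
countᵇ-cong p q m h = ≤-antisym
  (countᵇ-mono p q m (λ σ b → trans (sym (h σ b))))
  (countᵇ-mono q p m (λ σ b → trans (h σ b)))

toℕ-not : ∀ b → toℕ b + toℕ (not b) ≡ 1
toℕ-not true  = refl
toℕ-not false = refl

countᵇ-not : ∀ p m → countᵇ p m + countᵇ (not ∘ p) m ≡ 2 ^ m
countᵇ-not p zero rewrite countᵇ-zero p | countᵇ-zero (not ∘ p) = toℕ-not (p [])
countᵇ-not p (suc m) rewrite countᵇ-suc p m | countᵇ-suc (not ∘ p) m = begin
  (countᵇ p₀ m + countᵇ p₁ m) + (countᵇ (not ∘ p₀) m + countᵇ (not ∘ p₁) m)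
    ≡⟨ interchange (countᵇ p₀ m) _ _ _ ⟩
  (countᵇ p₀ m + countᵇ (not ∘ p₀) m) + (countᵇ p₁ m + countᵇ (not ∘ p₁) m)
    ≡⟨ cong₂ _+_ (countᵇ-not p₀ m) (countᵇ-not p₁ m) ⟩
  2 ^ m + 2 ^ m
    ≡⟨ cong (2 ^ m +_) (sym (+-identityʳ (2 ^ m))) ⟩
  2 ^ suc m ∎
  where
  open ≡-Reasoning
  p₀ = p ∘ (0 ∷_)
  p₁ = p ∘ (1 ∷_)

≡ᵇ-refl : ∀ x → (x ≡ᵇ x) ≡ true
≡ᵇ-refl zero    = refl
≡ᵇ-refl (suc x) = ≡ᵇ-refl x

prefixᵇ-∷⁺ : ∀ x σ τ → prefixᵇ σ τ ≡ true → prefixᵇ (x ∷ σ) (x ∷ τ) ≡ true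
prefixᵇ-∷⁺ x σ τ h rewrite ≡ᵇ-refl x = h

prefixᵇ-∷⁻ : ∀ x y σ τ → prefixᵇ (x ∷ σ) (y ∷ τ) ≡ true → x ≡ y × prefixᵇ σ τ ≡ true
prefixᵇ-∷⁻ x y σ τ h with x ≡ᵇ y in e
... | true = ≡ᵇ⇒≡ x y (subst T (sym e) _) , h

prefixᵇ-refl : ∀ σ → prefixᵇ σ σ ≡ true
prefixᵇ-refl []      = refl
prefixᵇ-refl (x ∷ σ) = prefixᵇ-∷⁺ x σ σ (prefixᵇ-refl σ)

prefixᵇ-trans : ∀ ρ σ τ → prefixᵇ ρ σ ≡ true → prefixᵇ σ τ ≡ true → prefixᵇ ρ τ ≡ true
prefixᵇ-trans []      σ       τ       _  _  = refl
prefixᵇ-trans (x ∷ ρ) (y ∷ σ) (z ∷ τ) h₁ h₂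
  with refl , p₁ ← prefixᵇ-∷⁻ x y ρ σ h₁ | refl , p₂ ← prefixᵇ-∷⁻ y z σ τ h₂ =
  prefixᵇ-∷⁺ x ρ τ (prefixᵇ-trans ρ σ τ p₁ p₂)

prefixᵇ-short : ∀ ρ σ τ → length ρ ≤ length σ → prefixᵇ σ τ ≡ true →
  prefixᵇ ρ τ ≡ prefixᵇ ρ σ
prefixᵇ-short []      σ       τ       _       _ = refl
prefixᵇ-short (x ∷ ρ) (y ∷ σ) (z ∷ τ) (s≤s l) h with refl , p ← prefixᵇ-∷⁻ y z σ τ h =
  cong ((x ≡ᵇ y) ∧_) (prefixᵇ-short ρ σ τ l p)

isBinary-prefix : ∀ σ τ → prefixᵇ σ τ ≡ true → isBinary τ ≡ true → isBinary σ ≡ true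
isBinary-prefix []      τ       _ _ = refl
isBinary-prefix (x ∷ σ) (y ∷ τ) p h with refl , p′ ← prefixᵇ-∷⁻ x y σ τ p =
  cong₂ _∧_ (∧-conicalˡ _ _ h) (isBinary-prefix σ τ p′ (∧-conicalʳ _ _ h))

PrefixClosed : (List ℕ → Bool) → Set
PrefixClosed p = ∀ σ τ → prefixᵇ σ τ ≡ true → p τ ≡ true → p σ ≡ true

DependsOnlyOnFirst : ℕ → (List ℕ → Bool) → Set
DependsOnlyOnFirst N p = ∀ σ τ → N ≤ length σ → prefixᵇ σ τ ≡ true → p τ ≡ p σ

prefixClosed-∷ : ∀ {p} x → PrefixClosed p → PrefixClosed (p ∘ (x ∷_))
prefixClosed-∷ x closed σ τ h = closed (x ∷ σ) (x ∷ τ) (prefixᵇ-∷⁺ x σ τ h)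

dependsOnlyOnFirst-∷ : ∀ {N p} x → DependsOnlyOnFirst N p → DependsOnlyOnFirst (N ∸ 1) (p ∘ (x ∷_))
dependsOnlyOnFirst-∷ {zero}  x dep σ τ _ h = dep (x ∷ σ) (x ∷ τ) z≤n (prefixᵇ-∷⁺ x σ τ h)
dependsOnlyOnFirst-∷ {suc N} x dep σ τ l h = dep (x ∷ σ) (x ∷ τ) (s≤s l) (prefixᵇ-∷⁺ x σ τ h)

countᵇ-one : ∀ p → countᵇ p 1 ≡ toℕ (p (0 ∷ [])) + toℕ (p (1 ∷ []))
countᵇ-one p = trans (countᵇ-suc p 0) (cong₂ _+_ (countᵇ-zero (p ∘ (0 ∷_))) (countᵇ-zero (p ∘ (1 ∷_))))

countᵇ-suc-≤ : ∀ p m → PrefixClosed p → countᵇ p (suc m) ≤ 2 * countᵇ p m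
countᵇ-suc-≤ p zero closed = begin
  countᵇ p 1                            ≡⟨ countᵇ-one p ⟩
  toℕ (p (0 ∷ [])) + toℕ (p (1 ∷ []))   ≤⟨ +-mono-≤ (root-≥ 0) (root-≥ 1) ⟩
  toℕ (p []) + toℕ (p [])               ≡⟨ cong (toℕ (p []) +_) (sym (+-identityʳ _)) ⟩
  2 * toℕ (p [])                        ≡⟨ cong (2 *_) (sym (countᵇ-zero p)) ⟩
  2 * countᵇ p 0                        ∎
  where
  open ≤-Reasoning
  root-≥ : ∀ x → toℕ (p (x ∷ [])) ≤ toℕ (p [])
  root-≥ x = toℕ-mono (closed [] (x ∷ []) refl)
countᵇ-suc-≤ p (suc m) closed rewrite countᵇ-suc p (suc m) | countᵇ-suc p m = begin
  countᵇ p₀ (suc m) + countᵇ p₁ (suc m)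
    ≤⟨ +-mono-≤ (countᵇ-suc-≤ p₀ m (prefixClosed-∷ 0 closed)) (countᵇ-suc-≤ p₁ m (prefixClosed-∷ 1 closed)) ⟩
  2 * countᵇ p₀ m + 2 * countᵇ p₁ m
    ≡⟨ sym (*-distribˡ-+ 2 (countᵇ p₀ m) _) ⟩
  2 * (countᵇ p₀ m + countᵇ p₁ m) ∎
  where
  open ≤-Reasoning
  p₀ = p ∘ (0 ∷_)
  p₁ = p ∘ (1 ∷_)

countᵇ-suc-≡ : ∀ p N m → DependsOnlyOnFirst N p → N ≤ m → countᵇ p (suc m) ≡ 2 * countᵇ p m
countᵇ-suc-≡ p N zero dep z≤n = begin
  countᵇ p 1                            ≡⟨ countᵇ-one p ⟩
  toℕ (p (0 ∷ [])) + toℕ (p (1 ∷ []))   ≡⟨ cong₂ _+_ (root-≡ 0) (root-≡ 1) ⟩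
  toℕ (p []) + toℕ (p [])               ≡⟨ cong (toℕ (p []) +_) (sym (+-identityʳ _)) ⟩
  2 * toℕ (p [])                        ≡⟨ cong (2 *_) (sym (countᵇ-zero p)) ⟩
  2 * countᵇ p 0                        ∎
  where
  open ≡-Reasoning
  root-≡ : ∀ x → toℕ (p (x ∷ [])) ≡ toℕ (p [])
  root-≡ x = cong toℕ (dep [] (x ∷ []) z≤n refl)
countᵇ-suc-≡ p N (suc m) dep l rewrite countᵇ-suc p (suc m) | countᵇ-suc p m = begin
  countᵇ p₀ (suc m) + countᵇ p₁ (suc m)
    ≡⟨ cong₂ _+_ (countᵇ-suc-≡ p₀ (N ∸ 1) m (dependsOnlyOnFirst-∷ 0 dep) (∸-monoˡ-≤ 1 l))
                 (countᵇ-suc-≡ p₁ (N ∸ 1) m (dependsOnlyOnFirst-∷ 1 dep) (∸-monoˡ-≤ 1 l)) ⟩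
  2 * countᵇ p₀ m + 2 * countᵇ p₁ m
    ≡⟨ sym (*-distribˡ-+ 2 (countᵇ p₀ m) _) ⟩
  2 * (countᵇ p₀ m + countᵇ p₁ m) ∎
  where
  open ≡-Reasoning
  p₀ = p ∘ (0 ∷_)
  p₁ = p ∘ (1 ∷_)

countᵇ-+-≤ : ∀ p d m → PrefixClosed p → countᵇ p (d + m) ≤ 2 ^ d * countᵇ p m
countᵇ-+-≤ p zero    m closed = ≤-reflexive (sym (*-identityˡ _))
countᵇ-+-≤ p (suc d) m closed = begin
  countᵇ p (suc d + m)        ≤⟨ countᵇ-suc-≤ p (d + m) closed ⟩
  2 * countᵇ p (d + m)        ≤⟨ *-monoʳ-≤ 2 (countᵇ-+-≤ p d m closed) ⟩
  2 * (2 ^ d * countᵇ p m)    ≡⟨ sym (*-assoc 2 (2 ^ d) _) ⟩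
  2 ^ suc d * countᵇ p m      ∎
  where open ≤-Reasoning

countᵇ-+-≡ : ∀ p N d m → DependsOnlyOnFirst N p → N ≤ m → countᵇ p (d + m) ≡ 2 ^ d * countᵇ p m
countᵇ-+-≡ p N zero    m dep l = sym (*-identityˡ _)
countᵇ-+-≡ p N (suc d) m dep l = begin
  countᵇ p (suc d + m)        ≡⟨ countᵇ-suc-≡ p N (d + m) dep (≤-trans l (m≤n+m m d)) ⟩
  2 * countᵇ p (d + m)        ≡⟨ cong (2 *_) (countᵇ-+-≡ p N d m dep l) ⟩
  2 * (2 ^ d * countᵇ p m)    ≡⟨ sym (*-assoc 2 (2 ^ d) _) ⟩
  2 ^ suc d * countᵇ p m      ∎
  where open ≡-Reasoning

*-scale-≤ : ∀ a b c K P → a ≤ c * b → b * K ≤ P → a * K ≤ c * P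
*-scale-≤ a b c K P a≤cb bK≤P = begin
  a * K         ≤⟨ *-monoˡ-≤ K a≤cb ⟩
  c * b * K     ≡⟨ *-assoc c b K ⟩
  c * (b * K)   ≤⟨ *-monoʳ-≤ c bK≤P ⟩
  c * P         ∎
  where open ≤-Reasoning

*-unscale-≤ : ∀ a b c K P .{{_ : NonZero c}} → a ≡ c * b → a * K ≤ c * P → b * K ≤ P
*-unscale-≤ a b c K P a≡cb aK≤cP = *-cancelˡ-≤ c (begin
  c * (b * K)   ≡⟨ sym (*-assoc c b K) ⟩
  c * b * K     ≡⟨ cong (_* K) (sym a≡cb) ⟩
  a * K         ≤⟨ aK≤cP ⟩
  c * P         ∎)
  where open ≤-Reasoning

-- With h + u = P: h ≥ (1 − 1/K) P iff u ≤ P/K, cleared of denominators.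
complement-≥⇒≤ : ∀ K P h u → h + u ≡ P → (K ∸ 1) * P ≤ h * K → u * K ≤ P
complement-≥⇒≤ K P h u h+u≡P le = +-cancelˡ-≤ (h * K) _ _ (begin
  h * K + u * K       ≡⟨ sym (*-distribʳ-+ K h u) ⟩
  (h + u) * K         ≡⟨ cong (_* K) h+u≡P ⟩
  P * K               ≡⟨ *-comm P K ⟩
  K * P               ≤⟨ *-monoˡ-≤ P (m≤n+m∸n K 1) ⟩
  P + (K ∸ 1) * P     ≤⟨ +-monoʳ-≤ P le ⟩
  P + h * K           ≡⟨ +-comm P (h * K) ⟩
  h * K + P           ∎)
  where open ≤-Reasoning

complement-≤⇒≥ : ∀ K P h u → h + u ≡ P → u * K ≤ P → (K ∸ 1) * P ≤ h * K
complement-≤⇒≥ K P h u h+u≡P le rewrite *-distribʳ-∸ P K 1 | *-identityˡ P =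
  m≤n+o⇒m∸n≤o (K * P) P (begin
    K * P             ≡⟨ *-comm K P ⟩
    P * K             ≡⟨ cong (_* K) (sym h+u≡P) ⟩
    (h + u) * K       ≡⟨ *-distribʳ-+ K h u ⟩
    h * K + u * K     ≤⟨ +-monoʳ-≤ (h * K) le ⟩
    h * K + P         ≡⟨ +-comm (h * K) P ⟩
    P + h * K         ∎)
  where open ≤-Reasoning

-- Thin k p m says L_m(p) ≤ 2^-k, where L_m(p) is the proportion of the sequences of length m satisfying p.
Thin : ℕ → (List ℕ → Bool) → ℕ → Set
Thin k p m = countᵇ p m * 2 ^ k ≤ 2 ^ m

thin-mono : ∀ k p m n → PrefixClosed p → m ≤ n → Thin k p m → Thin k p n
thin-mono k p m n closed m≤n thin = subst (Thin k p) (m∸n+n≡m m≤n) (begin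
  countᵇ p (d + m) * 2 ^ k   ≤⟨ *-scale-≤ _ _ (2 ^ d) _ _ (countᵇ-+-≤ p d m closed) thin ⟩
  2 ^ d * 2 ^ m              ≡⟨ sym (^-distribˡ-+-* 2 d m) ⟩
  2 ^ (d + m)                ∎)
  where
  open ≤-Reasoning
  d = n ∸ m

thin-down : ∀ k p N n → DependsOnlyOnFirst N p → N ≤ n → Thin k p n → Thin k p N
thin-down k p N n dep N≤n thin =
  *-unscale-≤ _ _ (2 ^ d) _ _ {{m^n≢0 2 d}} (countᵇ-+-≡ p N d N dep ≤-refl) (begin
    countᵇ p (d + N) * 2 ^ k   ≡⟨ cong (λ m → countᵇ p m * 2 ^ k) (m∸n+n≡m N≤n) ⟩
    countᵇ p n * 2 ^ k         ≤⟨ thin ⟩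
    2 ^ n                      ≡⟨ cong (2 ^_) (sym (m∸n+n≡m N≤n)) ⟩
    2 ^ (d + N)                ≡⟨ ^-distribˡ-+-* 2 d N ⟩
    2 ^ d * 2 ^ N              ∎)
  where
  open ≤-Reasoning
  d = n ∸ N

thin-transfer : ∀ k p N n → PrefixClosed p → DependsOnlyOnFirst N p → Thin k p n → Thin k p N
thin-transfer k p N n closed dep thin with ≤-total n N
... | inj₁ n≤N = thin-mono k p n N closed n≤N thin
... | inj₂ N≤n = thin-down k p N n dep N≤n thin

anyᵇ-∈ : ∀ {A : Set} (p : A → Bool) {x} xs → x ∈ xs → p x ≡ true → anyᵇ p xs ≡ true
anyᵇ-∈ p (y ∷ xs) (here refl) px rewrite px = refl
anyᵇ-∈ p (y ∷ xs) (there x∈xs) px with p y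
... | true  = refl
... | false = anyᵇ-∈ p xs x∈xs px

anyᵇ-∃ : ∀ {A : Set} (p : A → Bool) xs → anyᵇ p xs ≡ true → ∃ λ x → x ∈ xs × p x ≡ true
anyᵇ-∃ p (x ∷ xs) h with p x in px
... | true  = x , here refl , px
... | false with y , y∈xs , py ← anyᵇ-∃ p xs h = y , there y∈xs , py

anyᵇ-cong : ∀ {A : Set} (p q : A → Bool) xs → (∀ x → x ∈ xs → p x ≡ q x) →
  anyᵇ p xs ≡ anyᵇ q xs
anyᵇ-cong p q []       h = refl
anyᵇ-cong p q (x ∷ xs) h = cong₂ _∨_ (h x (here refl)) (anyᵇ-cong p q xs (λ y → h y ∘ there))

≤-foldr-⊔ : ∀ {A : Set} (f : A → ℕ) {x} xs → x ∈ xs → f x ≤ foldr (λ y m → f y ⊔ m) 0 xs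
≤-foldr-⊔ f (y ∷ xs) (here refl)  = m≤m⊔n (f y) _
≤-foldr-⊔ f (y ∷ xs) (there x∈xs) = ≤-trans (≤-foldr-⊔ f xs x∈xs) (m≤n⊔m (f y) _)

foldr-⊔-lub : ∀ {A : Set} (f : A → ℕ) n xs → (∀ x → x ∈ xs → f x ≤ n) →
  foldr (λ y m → f y ⊔ m) 0 xs ≤ n
foldr-⊔-lub f n []       h = z≤n
foldr-⊔-lub f n (x ∷ xs) h = ⊔-lub (h x (here refl)) (foldr-⊔-lub f n xs (λ y → h y ∘ there))

length-bar : ∀ α n → length (bar α n) ≡ n
length-bar α n = trans (length-map α (upTo n)) (length-upTo n)

binaryTree : (List ℕ → Bool) → List ℕ → Bool
binaryTree p σ = isBinary σ ∧ p σ

binaryTree-isBinTree : ∀ p → PrefixClosed p → IsBinTree (binaryTree p)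
binaryTree-isBinTree p closed =
  (λ σ h → ∧-conicalˡ _ _ h) ,
  (λ σ τ σ≼τ h → cong₂ _∧_ (isBinary-prefix σ τ σ≼τ (∧-conicalˡ _ _ h))
                           (closed σ τ σ≼τ (∧-conicalʳ _ _ h)))

countᵇ-binaryTree : ∀ p m → countᵇ (binaryTree p) m ≡ countᵇ p m
countᵇ-binaryTree p m = countᵇ-cong _ p m (λ σ b → cong (_∧ p σ) b)

not-prefixClosed : ∀ p → (∀ σ τ → prefixᵇ σ τ ≡ true → p σ ≡ true → p τ ≡ true) →
  PrefixClosed (not ∘ p)
not-prefixClosed p upward σ τ σ≼τ h with p σ in pσ
... | false = refl
... | true  = trans (cong not (sym (upward σ τ σ≼τ pσ))) h

module Cylinders (G : ⟦ ty2 ⟧) (s : ⟦ ty1* ⟧) where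

  uncovered : List ℕ → Bool
  uncovered = not ∘ cylHit G s

  cylHit-∈ : ∀ {α} σ → α ∈ elems s → prefixᵇ (bar α (G α)) σ ≡ true → cylHit G s σ ≡ true
  cylHit-∈ σ = anyᵇ-∈ (λ g → prefixᵇ (bar g (G g)) σ) (elems s)

  uncovered-prefixClosed : PrefixClosed uncovered
  uncovered-prefixClosed = not-prefixClosed (cylHit G s) λ σ τ σ≼τ h →
    let α , α∈s , hit = anyᵇ-∃ _ (elems s) h
    in  cylHit-∈ τ α∈s (prefixᵇ-trans (bar α (G α)) σ τ hit σ≼τ)

  uncovered-dependsOnlyOnFirst : DependsOnlyOnFirst (cylLen G s) uncovered
  uncovered-dependsOnlyOnFirst σ τ l σ≼τ = cong not (anyᵇ-cong _ _ (elems s) λ α α∈s →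
    prefixᵇ-short (bar α (G α)) σ τ
      (≤-trans (≤-reflexive (length-bar α (G α))) (≤-trans (≤-foldr-⊔ G (elems s) α∈s) l)) σ≼τ)

  -- A cylinder meeting T would put its stem into T.
  tree-uncovered : ∀ T → PrefixClosed T → (∀ α → α ∈ elems s → T (bar α (G α)) ≡ false) →
    ∀ σ → T σ ≡ true → uncovered σ ≡ true
  tree-uncovered T closed avoid σ h with cylHit G s σ in hit
  ... | false = refl
  ... | true with α , α∈s , stem ← anyᵇ-∃ _ (elems s) hit =
    trans (sym (avoid α α∈s)) (closed _ σ stem h)

  stem-covered : ∀ α → α ∈ elems s → binaryTree uncovered (bar α (G α)) ≡ false
  stem-covered α α∈s rewrite cylHit-∈ (bar α (G α)) α∈s (prefixᵇ-refl (bar α (G α))) =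
    ∧-zeroʳ (isBinary (bar α (G α)))

  private
    N = cylLen G s

  wff⇒thin : ∀ k → (2 ^ k ∸ 1) * 2 ^ N ≤ countᵇ (cylHit G s) N * 2 ^ k → Thin k uncovered N
  wff⇒thin k = complement-≥⇒≤ (2 ^ k) (2 ^ N) (countᵇ (cylHit G s) N) (countᵇ uncovered N) (countᵇ-not (cylHit G s) N)

  thin⇒wff : ∀ k → Thin k uncovered N → (2 ^ k ∸ 1) * 2 ^ N ≤ countᵇ (cylHit G s) N * 2 ^ k
  thin⇒wff k = complement-≤⇒≥ (2 ^ k) (2 ^ N) (countᵇ (cylHit G s) N) (countᵇ uncovered N) (countᵇ-not (cylHit G s) N)

plusR : ℕ → ℕ → ℕ
plusR a r = R₀ r (λ _ → suc) a

sumR : (ℕ → ℕ) → ℕ → ℕ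
sumR f n = R₀ 0 (λ i r → plusR (f i) r) n

plusR≡+ : ∀ a r → plusR a r ≡ a + r
plusR≡+ zero    r = refl
plusR≡+ (suc a) r = cong suc (plusR≡+ a r)

≤-sumR : ∀ f n i → i < n → f i ≤ sumR f n
≤-sumR f (suc n) i (s≤s i≤n) rewrite plusR≡+ (f n) (sumR f n) with m≤n⇒m<n∨m≡n i≤n
... | inj₁ i<n  = ≤-trans (≤-sumR f n i i<n) (m≤n+m _ (f n))
... | inj₂ refl = m≤m+n (f i) _

cylLen≤sumR : ∀ (G : ⟦ ty2 ⟧) len β → cylLen G (len , β) ≤ sumR (G ∘ β) len
cylLen≤sumR G len β = foldr-⊔-lub G _ (elems (len , β)) λ α α∈s →
  let i , i∈ , α≡βi = ∈-map⁻ β α∈s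
  in  subst (λ α → G α ≤ sumR (G ∘ β) len) (sym α≡βi) (≤-sumR (G ∘ β) len i (∈-upTo⁻ i∈))

infixl 9 _·_

_·_ : ∀ {Γ σ τ} → Tm Γ (σ ⇒ τ) → Tm Γ σ → Tm Γ τ
_·_ = app

v0 : ∀ {Γ σ} → Tm (σ ∷ Γ) σ
v0 = var here

v1 : ∀ {Γ σ τ} → Tm (τ ∷ σ ∷ Γ) σ
v1 = var (there here)

v2 : ∀ {Γ σ τ₁ τ₂} → Tm (τ₂ ∷ τ₁ ∷ σ ∷ Γ) σ
v2 = var (there (there here))

v3 : ∀ {Γ σ τ₁ τ₂ τ₃} → Tm (τ₃ ∷ τ₂ ∷ τ₁ ∷ σ ∷ Γ) σ
v3 = var (there (there (there here)))

plusᵀ : ∀ {Γ} → Tm Γ (ι ⇒ ι ⇒ ι)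
plusᵀ = lam (lam (rec₀ · v0 · lam (lam (suc' · v0)) · v1))

sumᵀ : ∀ {Γ} → Tm Γ ((ι ⇒ ι) ⇒ ι ⇒ ι)
sumᵀ = lam (lam (rec₀ · zer · lam (lam (plusᵀ · (v3 · v1) · v0)) · v0))

-- t Λ g k = (Σ_{i < len} g (β i) , Λ g k) for Λ g k = (len , β): the sum bounds every stem length.
wcfOfWff : Tm [] (tyΛ ⇒ tyη)
wcfOfWff = lam (lam (lam (pair (sumᵀ · lam (v2 · (snd (v3 · v2 · v1) · v0)) · fst (v2 · v1 · v0))
                               (v2 · v1 · v0))))

wffOfWcf : Tm [] (tyη ⇒ tyΛ)
wffOfWcf = lam (lam (lam (snd (v2 · v1 · v0))))

wff⇒wcf : ∀ Λ → WFF Λ → WCF (⟦ wcfOfWff ⟧ᶜ Λ)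
wff⇒wcf Λ wff k g T (_ , closed) avoid =
  ≤-trans (*-monoˡ-≤ (2 ^ k) (countᵇ-mono T uncovered n (λ σ _ → tree-uncovered T closed avoid σ)))
    (thin-mono k uncovered (cylLen g s) n uncovered-prefixClosed (cylLen≤sumR g len β)
      (wff⇒thin k (wff g k)))
  where
  s = Λ g k
  len = proj₁ s
  β = proj₂ s
  n = sumR (g ∘ β) len
  open Cylinders g s

wcf⇒wff : ∀ η → WCF η → WFF (⟦ wffOfWcf ⟧ᶜ η)
wcf⇒wff η wcf G k = thin⇒wff k (thin-transfer k uncovered (cylLen G s) n
    uncovered-prefixClosed uncovered-dependsOnlyOnFirst
    (subst (λ c → c * 2 ^ k ≤ 2 ^ n) (countᵇ-binaryTree uncovered n)
      (wcf k G (binaryTree uncovered) (binaryTree-isBinTree uncovered uncovered-prefixClosed) stem-covered)))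
  where
  n = proj₁ (η G k)
  s = proj₂ (η G k)
  open Cylinders G s

theorem2p26 : Σ (Tm [] (tyΛ ⇒ tyη)) λ t → Σ (Tm [] (tyη ⇒ tyΛ)) λ s →
    (∀ (Λ : ⟦ tyΛ ⟧) → WFF Λ → WCF (⟦ t ⟧ᶜ Λ)) ×
    (∀ (η : ⟦ tyη ⟧) → WCF η → WFF (⟦ s ⟧ᶜ η))
theorem2p26 = wcfOfWff , wffOfWcf , wff⇒wcf , wcf⇒wff
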